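{- Let $k$ be a positive integer and let $S_1$ and $S_2$ be two submonoids of $\mathcal{U}_k$ that contain $\mathfrak{S}_k$. Then $S_1\cup S_2$ is also a submonoid of $\mathcal{U}_k$. (Consequently, the submonoids of $\mathcal{U}_k$ containing $\mathfrak{S}_k$ form a distributive lattice under union and intersection.)
   Context: Let $[k]=\{1,\dots,k\}$, $[\bar k]=\{\bar 1,\dots,\bar k\}$. $\mathcal{U}_k$ (the uniform block permutation monoid) is the set of set partitions of $[k]\cup[\bar k]$ all of whose blocks $A$ satisfy $|A\cap[k]|=|A\cap[\bar k]|$, with product given by diagram concatenation: for $\pi,\gamma\in\mathcal{U}_k$, place $\pi$ on $[k]\cup M$ (renaming $\bar i$ to $i'$) and $\gamma$ on $M\cup[\bar k]$ (renaming $i$ to $i'$), $M=\{1',\dots,k'\}$, take the join (connected components) of these two set partitions of $[k]\cup M\cup[\bar k]$, and restrict to $[k]\cup[\bar k]$. The symmetric group $\mathfrak{S}_k$ is embedded in $\mathcal{U}_k$ via $\sigma\mapsto\{\{\sigma(i),\bar i\}:i\in[k]\}$; it is the group of units of $\mathcal{U}_k$. -}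

module Defs where

open import Data.Nat using (ℕ; zero; suc; _+_; _*_)
open import Data.Fin using (Fin; zero; suc; _≟_)
open import Data.Fin.Permutation using (Permutation′; _⟨$⟩ʳ_)
open import Data.Bool using (Bool; true; false; _∧_; _∨_; if_then_else_)
open import Data.Sum using (_⊎_; inj₁; inj₂)
open import Data.Product using (_×_; _,_)
open import Relation.Nullary.Decidable using (⌊_⌋)
open import Relation.Binary.PropositionalEquality using (_≡_)
open import Data.Empty using (⊥)

-- Points of [k] ∪ [k̄]:  inj₁ i = i (top row),  inj₂ i = ī (bottom row).

Pt : ℕ → Set
Pt k = Fin k ⊎ Fin k

-- A (raw) diagram: a Boolean "same block" relation on [k] ∪ [k̄].
-- Set partitions are those raw diagrams that are equivalence relations.
Diagram : ℕ → Set
Diagram k = Pt k → Pt k → Bool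

_≈_ : ∀ {k} → Diagram k → Diagram k → Set
d ≈ e = ∀ x y → d x y ≡ e x y

anyFin : ∀ {k} → (Fin k → Bool) → Bool
anyFin {zero}  f = false
anyFin {suc k} f = f zero ∨ anyFin (λ i → f (suc i))

countFin : ∀ {k} → (Fin k → Bool) → ℕ
countFin {zero}  f = zero
countFin {suc k} f = (if f zero then 1 else 0) + countFin (λ i → f (suc i))

_==_ : ∀ {k} → Fin k → Fin k → Bool
a == b = ⌊ a ≟ b ⌋

record InU (k : ℕ) (d : Diagram k) : Set where
  field
    refl'  : ∀ x → d x x ≡ true
    sym'   : ∀ x y → d x y ≡ true → d y x ≡ true
    trans' : ∀ x y z → d x y ≡ true → d y z ≡ true → d x z ≡ true
    uniform : ∀ x → countFin (λ i → d x (inj₁ i)) ≡ countFin (λ i → d x (inj₂ i))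

-- Product by concatenation.  Vertices of [k] ∪ M ∪ [k̄]:

data Row : Set where
  top mid bot : Row

V : ℕ → Set
V k = Row × Fin k

anyV : ∀ {k} → (V k → Bool) → Bool
anyV f = anyFin (λ i → f (top , i)) ∨ (anyFin (λ i → f (mid , i)) ∨ anyFin (λ i → f (bot , i)))

_==V_ : ∀ {k} → V k → V k → Bool
(top , a) ==V (top , b) = a == b
(mid , a) ==V (mid , b) = a == b
(bot , a) ==V (bot , b) = a == b
_ ==V _ = false

-- Edges of the union of π (placed on [k] ∪ M, ī ↦ i') and
-- γ (placed on M ∪ [k̄], i ↦ i').
edge : ∀ {k} → Diagram k → Diagram k → V k → V k → Bool
edge π γ (top , a) (top , b) = π (inj₁ a) (inj₁ b)
edge π γ (top , a) (mid , b) = π (inj₁ a) (inj₂ b)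
edge π γ (mid , a) (top , b) = π (inj₂ a) (inj₁ b)
edge π γ (mid , a) (mid , b) = π (inj₂ a) (inj₂ b) ∨ γ (inj₁ a) (inj₁ b)
edge π γ (mid , a) (bot , b) = γ (inj₁ a) (inj₂ b)
edge π γ (bot , a) (mid , b) = γ (inj₂ a) (inj₁ b)
edge π γ (bot , a) (bot , b) = γ (inj₂ a) (inj₂ b)
edge π γ _ _ = false

reach : ∀ {k} → Diagram k → Diagram k → ℕ → V k → V k → Bool
reach π γ zero    x y = x ==V y
reach π γ (suc n) x y = reach π γ n x y ∨ anyV (λ z → reach π γ n x z ∧ edge π γ z y)

embed : ∀ {k} → Pt k → V k
embed (inj₁ a) = (top , a)
embed (inj₂ a) = (bot , a)

-- The join (connected components; paths of length ≤ 3k suffice on 3k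
-- vertices) restricted to [k] ∪ [k̄].
_·_ : ∀ {k} → Diagram k → Diagram k → Diagram k
_·_ {k} π γ x y = reach π γ (3 * k) (embed x) (embed y)

perm : ∀ {k} → Permutation′ k → Diagram k
perm σ (inj₁ a) (inj₁ b) = a == b
perm σ (inj₂ a) (inj₂ b) = a == b
perm σ (inj₁ a) (inj₂ b) = a == (σ ⟨$⟩ʳ b)
perm σ (inj₂ b) (inj₁ a) = a == (σ ⟨$⟩ʳ b)

one : ∀ {k} → Diagram k
one (inj₁ a) (inj₁ b) = a == b
one (inj₂ a) (inj₂ b) = a == b
one (inj₁ a) (inj₂ b) = a == b
one (inj₂ a) (inj₁ b) = a == b

Subset : ℕ → Set₁
Subset k = Diagram k → Set

record IsSubmonoid (k : ℕ) (S : Subset k) : Set where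
  field
    respects : ∀ {d e} → d ≈ e → S d → S e
    ⊆U       : ∀ {d} → S d → InU k d
    has-one  : S one
    closed   : ∀ {d e} → S d → S e → S (d · e)

ContainsSym : (k : ℕ) → Subset k → Set
ContainsSym k S = (σ : Permutation′ k) → S (perm σ)

_∪_ : ∀ {k} → Subset k → Subset k → Subset k
(S ∪ T) d = S d ⊎ T d

-- Every uniform block permutation is σ e_A τ with σ, τ ∈ 𝔖_k and e_A the idempotent of a set
-- partition A of [k] (whose blocks are the sets A ∪ Ā). Hence the partitions whose idempotents lie in
-- a submonoid S ⊇ 𝔖_k are closed under conjugation by 𝔖_k and under joins (e_A e_B = e_{A ∨ B}), and
-- for d ∈ S₁, e ∈ S₂ the product d e is, up to permutations, the idempotent of P ∨ Q, where P is the
-- partition of the bottom row of d and Q that of the top row of e.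
-- Say the smallest non-trivial block of P is no larger than every non-trivial block of Q. Then
-- P ∨ Q is the join of conjugates of P that lie below P ∨ Q, so e_{P ∨ Q} ∈ S₁: to relate a and b
-- in the same block B of P ∨ Q, either P already relates two points of B, which two transpositions
-- inside B move onto a and b, or P is discrete on B, and then B contains a non-trivial block of Q,
-- so a smallest non-trivial block of P can be swapped into B so as to cover a and b.
-- Otherwise the symmetric argument puts e_{Q ∨ P} in S₂.

module Submission where

open import Defs
open import Data.Nat using (ℕ; zero; suc; _+_; _*_; _∸_; _≤_; _<_; _≥_; z≤n; s≤s; _<ᵇ_; _≤?_)
import Data.Nat as ℕ
open import Data.Nat.Properties hiding (_≟_)
open import Data.Fin using (Fin; zero; suc; _≟_; toℕ; fromℕ<)
import Data.Fin.Properties as Fin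
open import Data.Fin.Permutation using (Permutation′; _⟨$⟩ʳ_; _⟨$⟩ˡ_; inverseˡ; inverseʳ; flip; transpose; _∘ₚ_)
import Data.Fin.Permutation as Perm
open import Data.Bool using (Bool; true; false; _∧_; _∨_; not; T; if_then_else_)
open import Data.Bool.Properties using (¬-not; ∧-identityʳ)
import Data.Bool.Properties as Bool
open import Data.Sum using (_⊎_; inj₁; inj₂; [_,_]′)
import Data.Sum as Sum
open import Data.Product using (∃-syntax; _×_; _,_; proj₁; proj₂)
open import Data.Empty using (⊥-elim)
open import Relation.Binary.PropositionalEquality
open import Relation.Nullary using (¬_; yes; no; Dec; ¬?; _×-dec_)
open import Relation.Binary.Construct.Closure.ReflexiveTransitive using (Star; ε; _◅_; _◅◅_; gmap; fold; reverse)
open import Relation.Binary.Construct.Union using () renaming (_∪_ to _∪ᴿ_)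
open import Relation.Binary using (Setoid; IsEquivalence; Reflexive; Transitive)
open import Function using (id; Equivalence)
open import Data.List using (List; []; _∷_; allFin; cartesianProduct)
open import Data.List.Membership.Propositional using (_∈_)
open import Data.List.Membership.Propositional.Properties using (∈-allFin; ∈-cartesianProduct⁺)
open import Data.List.Relation.Unary.Any using (here; there)
import Relation.Binary.Reasoning.Setoid as SetoidReasoning
open import Relation.Nullary.Decidable using (isYes≗does; dec-true; dec-false; toWitness)
open import Algebra.Properties.CommutativeMonoid.Sum +-0-commutativeMonoid using (sum; sum-permute)

true≢false : true ≢ false
true≢false ()

∨-introˡ : ∀ {a} b → a ≡ true → a ∨ b ≡ true
∨-introˡ b refl = refl

∨-introʳ : ∀ a {b} → b ≡ true → a ∨ b ≡ true
∨-introʳ true  _ = refl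
∨-introʳ false p = p

∨-elim : ∀ a {b} → a ∨ b ≡ true → a ≡ true ⊎ b ≡ true
∨-elim true  _ = inj₁ refl
∨-elim false p = inj₂ p

∧-intro : ∀ {a b} → a ≡ true → b ≡ true → a ∧ b ≡ true
∧-intro refl refl = refl

∧-elimˡ : ∀ a {b} → a ∧ b ≡ true → a ≡ true
∧-elimˡ true  _ = refl

∧-elimʳ : ∀ a {b} → a ∧ b ≡ true → b ≡ true
∧-elimʳ true p = p

≡-from-true⇔true : ∀ {a b} → (a ≡ true → b ≡ true) → (b ≡ true → a ≡ true) → a ≡ b
≡-from-true⇔true {true}  {true}  f g = refl
≡-from-true⇔true {true}  {false} f g = sym (f refl)
≡-from-true⇔true {false} {true}  f g = g refl
≡-from-true⇔true {false} {false} f g = refl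

search : ∀ {k} (f : Fin k → Bool) → (∀ i → f i ≡ false) ⊎ ∃[ i ] f i ≡ true
search f with Fin.any? (λ i → f i Bool.≟ true)
... | yes found = inj₂ found
... | no  none  = inj₁ λ i → ¬-not λ fi → none (i , fi)

module _ {k : ℕ} where

  ==-sound : {a b : Fin k} → a == b ≡ true → a ≡ b
  ==-sound p = toWitness (subst T (sym p) _)

  ==-complete : {a b : Fin k} → a ≡ b → a == b ≡ true
  ==-complete {a} {b} a≡b = trans (isYes≗does (a ≟ b)) (dec-true (a ≟ b) a≡b)

  ==-refl : (a : Fin k) → a == a ≡ true
  ==-refl a = ==-complete refl

  ==-false : {a b : Fin k} → a ≢ b → a == b ≡ false
  ==-false {a} {b} a≢b = trans (isYes≗does (a ≟ b)) (dec-false (a ≟ b) a≢b)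

  anyFin-elim : (f : Fin k → Bool) → anyFin f ≡ true → ∃[ i ] f i ≡ true
  anyFin-elim f p with search f
  ... | inj₂ found = found
  ... | inj₁ none  = ⊥-elim (true≢false (trans (sym p) (anyFin-none f none)))
    where
      anyFin-none : ∀ {n} (g : Fin n → Bool) → (∀ i → g i ≡ false) → anyFin g ≡ false
      anyFin-none {zero}  g none = refl
      anyFin-none {suc n} g none rewrite none zero = anyFin-none (λ i → g (suc i)) (λ i → none (suc i))

anyFin-intro : ∀ {k} (f : Fin k → Bool) i → f i ≡ true → anyFin f ≡ true
anyFin-intro f zero    p rewrite p = refl
anyFin-intro f (suc i) p = ∨-introʳ (f zero) (anyFin-intro (λ j → f (suc j)) i p)

anyFin-cong : ∀ {k} {f g : Fin k → Bool} → (∀ i → f i ≡ g i) → anyFin f ≡ anyFin g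
anyFin-cong {zero}  h = refl
anyFin-cong {suc k} h = cong₂ _∨_ (h zero) (anyFin-cong (λ i → h (suc i)))

search₂ : ∀ {k} (f : Fin k → Fin k → Bool) → (∀ i j → f i j ≡ false) ⊎ ∃[ i ] ∃[ j ] f i j ≡ true
search₂ f with search (λ i → anyFin (f i))
... | inj₂ (i , p) = let j , q = anyFin-elim (f i) p in inj₂ (i , j , q)
... | inj₁ none = inj₁ λ i j → ¬-not λ q → true≢false (trans (sym (anyFin-intro (f i) j q)) (none i))

_⊆ᵇ_ : ∀ {A : Set} → (A → Bool) → (A → Bool) → Set
P ⊆ᵇ Q = ∀ x → P x ≡ true → Q x ≡ true

Holds : ∀ {A : Set} → (A → A → Bool) → A → A → Set
Holds R x y = R x y ≡ true

_⊆ʳ_ : ∀ {A : Set} → (A → A → Bool) → (A → A → Bool) → Set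
R ⊆ʳ R′ = ∀ x → R x ⊆ᵇ R′ x

remove : ∀ {k} → Fin k → (Fin k → Bool) → Fin k → Bool
remove c f x = f x ∧ not (x == c)

insert : ∀ {k} → Fin k → (Fin k → Bool) → Fin k → Bool
insert c f x = f x ∨ (x == c)

remove-⊆ : ∀ {k} c (f : Fin k → Bool) → remove c f ⊆ᵇ f
remove-⊆ c f x = ∧-elimˡ (f x)

remove-≢ : ∀ {k} c (f : Fin k → Bool) x → remove c f x ≡ true → x ≢ c
remove-≢ c f x p x≡c = true≢false (trans (sym (∧-elimʳ (f x) p)) (cong not (==-complete x≡c)))

remove-keep : ∀ {k} c (f : Fin k → Bool) {x} → f x ≡ true → x ≢ c → remove c f x ≡ true
remove-keep c f fx x≢c = ∧-intro fx (cong not (==-false x≢c))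

==-suc : ∀ {k} (i j : Fin k) → (suc i == suc j) ≡ (i == j)
==-suc i j = ≡-from-true⇔true (λ p → ==-complete (Fin.suc-injective (==-sound p)))
                              (λ p → ==-complete (cong suc (==-sound p)))

count-cong : ∀ {k} {f g : Fin k → Bool} → (∀ i → f i ≡ g i) → countFin f ≡ countFin g
count-cong {zero}  h = refl
count-cong {suc k} h = cong₂ _+_ (cong (λ b → if b then 1 else 0) (h zero)) (count-cong (λ i → h (suc i)))

count-false : ∀ {k} → countFin {k} (λ _ → false) ≡ 0
count-false {zero}  = refl
count-false {suc k} = count-false {k}

count-≤ : ∀ {k} (f : Fin k → Bool) → countFin f ≤ k
count-≤ {zero}  f = z≤n
count-≤ {suc k} f with f zero
... | true  = s≤s (count-≤ (λ i → f (suc i)))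
... | false = m≤n⇒m≤1+n (count-≤ (λ i → f (suc i)))

count-mono : ∀ {k} {f g : Fin k → Bool} → f ⊆ᵇ g → countFin f ≤ countFin g
count-mono {zero}              f⊆g = z≤n
count-mono {suc k} {f} {g} f⊆g with f zero in fz | g zero in gz
... | true  | true  = s≤s (count-mono (λ i → f⊆g (suc i)))
... | true  | false = ⊥-elim (true≢false (trans (sym (f⊆g zero fz)) gz))
... | false | true  = m≤n⇒m≤1+n (count-mono (λ i → f⊆g (suc i)))
... | false | false = count-mono (λ i → f⊆g (suc i))

count-remove : ∀ {k} (f : Fin k → Bool) c → f c ≡ true → countFin f ≡ suc (countFin (remove c f))
count-remove {suc k} f zero fc rewrite fc | ==-refl {suc k} zero =
  cong suc (count-cong λ i → sym (trans (cong (λ b → f (suc i) ∧ not b) (==-false {a = suc i} {zero} λ ())) (∧-identityʳ _)))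
count-remove {suc k} f (suc c) fc = begin
  b + countFin (λ i → f (suc i))                    ≡⟨ cong (b +_) (count-remove (λ i → f (suc i)) c fc) ⟩
  b + suc (countFin (remove c (λ i → f (suc i))))    ≡⟨ +-suc b _ ⟩
  suc (b + countFin (remove c (λ i → f (suc i))))    ≡⟨ cong suc (cong₂ _+_ (cong (λ x → if x then 1 else 0) at-zero)
                                                                          (count-cong at-suc)) ⟩
  suc (countFin (remove (suc c) f))                  ∎
  where
    open ≡-Reasoning
    b = if f zero then 1 else 0
    at-zero : f zero ≡ remove (suc c) f zero
    at-zero = sym (trans (cong (λ x → f zero ∧ not x) (==-false {a = zero} {suc c} λ ())) (∧-identityʳ _))
    at-suc : ∀ i → remove c (λ j → f (suc j)) i ≡ remove (suc c) f (suc i)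
    at-suc i = cong (λ x → f (suc i) ∧ not x) (sym (==-suc i c))

count-strict : ∀ {k} {f g : Fin k → Bool} → f ⊆ᵇ g → ∀ j → f j ≡ false → g j ≡ true →
  suc (countFin f) ≤ countFin g
count-strict {f = f} {g} f⊆g j fj gj =
  subst (suc (countFin f) ≤_) (sym (count-remove g j gj)) (s≤s (count-mono f⊆g∖j))
  where
    f⊆g∖j : f ⊆ᵇ remove j g
    f⊆g∖j x fx = remove-keep j g (f⊆g x fx) λ { refl → true≢false (trans (sym fx) fj) }

count-≥1 : ∀ {k} (f : Fin k → Bool) x → f x ≡ true → 1 ≤ countFin f
count-≥1 f x fx = subst (1 ≤_) (sym (count-remove f x fx)) (s≤s z≤n)

count-≥1-elim : ∀ {k} (f : Fin k → Bool) → 1 ≤ countFin f → ∃[ x ] f x ≡ true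
count-≥1-elim {k} f 1≤ with search f
... | inj₂ found = found
... | inj₁ none  = ⊥-elim (1+n≰n (subst (1 ≤_) (trans (count-cong none) (count-false {k})) 1≤))

count-≥2 : ∀ {k} (f : Fin k → Bool) a b → f a ≡ true → f b ≡ true → a ≢ b → 2 ≤ countFin f
count-≥2 f a b fa fb a≢b = subst (2 ≤_) (sym (count-remove f a fa))
  (s≤s (count-≥1 (remove a f) b (remove-keep a f fb λ b≡a → a≢b (sym b≡a))))

count-≥2-elim : ∀ {k} (f : Fin k → Bool) → 2 ≤ countFin f → ∀ z → ∃[ w ] f w ≡ true × w ≢ z
count-≥2-elim f 2≤ z with count-≥1-elim (remove z f) (≤-pred (≤-trans 2≤ count-≤suc-remove))
  where
    count-≤suc-remove : countFin f ≤ suc (countFin (remove z f))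
    count-≤suc-remove with f z in fz
    ... | true  = ≤-reflexive (count-remove f z fz)
    ... | false = m≤n⇒m≤1+n (count-mono {g = remove z f} λ x fx → remove-keep z f fx λ { refl → true≢false (trans (sym fx) fz) })
... | w , w∈ = w , remove-⊆ z f w w∈ , remove-≢ z f w w∈

count-insert : ∀ {k} (f : Fin k → Bool) c → f c ≡ false → countFin (insert c f) ≡ suc (countFin f)
count-insert f c fc = trans (count-remove (insert c f) c (∨-introʳ (f c) (==-refl c)))
                            (cong suc (count-cong removed))
  where
    removed : ∀ x → remove c (insert c f) x ≡ f x
    removed x with x ≟ c
    ... | yes refl rewrite fc = refl
    ... | no x≢c with f x
    ...   | true  = refl
    ...   | false = refl

count-permute : ∀ {k} (f : Fin k → Bool) (π : Permutation′ k) → countFin (λ i → f (π ⟨$⟩ʳ i)) ≡ countFin f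
count-permute f π = begin
  countFin (λ i → f (π ⟨$⟩ʳ i))        ≡⟨ as-sum (λ i → f (π ⟨$⟩ʳ i)) ⟩
  sum (λ i → indicator (π ⟨$⟩ʳ i))     ≡⟨ sum-permute indicator π ⟨
  sum indicator                         ≡⟨ as-sum f ⟨
  countFin f                            ∎
  where
    open ≡-Reasoning
    indicator : Fin _ → ℕ
    indicator i = if f i then 1 else 0
    as-sum : ∀ {n} (g : Fin n → Bool) → countFin g ≡ sum (λ i → if g i then 1 else 0)
    as-sum {zero}  g = refl
    as-sum {suc n} g = cong ((if g zero then 1 else 0) +_) (as-sum (λ i → g (suc i)))

choose-between : ∀ {k} m (base f : Fin k → Bool) → base ⊆ᵇ f → countFin base + m ≤ countFin f →
  ∃[ g ] base ⊆ᵇ g × g ⊆ᵇ f × countFin g ≡ countFin base + m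
choose-between zero base f base⊆f _ = base , (λ _ p → p) , base⊆f , sym (+-identityʳ _)
choose-between (suc m) base f base⊆f room with search (λ x → f x ∧ not (base x))
... | inj₁ none = ⊥-elim (1+n≰n (≤-trans (subst (_≤ countFin f) (+-suc _ m) room)
                                        (≤-trans (count-mono f⊆base) (m≤m+n _ m))))
  where
    f⊆base : f ⊆ᵇ base
    f⊆base x fx = ¬-not λ bx → true≢false (trans (sym (∧-intro fx (cong not bx))) (none x))
... | inj₂ (c , c-new) = enlarge (choose-between m (insert c base) f insert⊆f room′)
  where
    base-c : base c ≡ false
    base-c = Bool.not-injective (∧-elimʳ (f c) c-new)
    grows : countFin (insert c base) ≡ suc (countFin base)
    grows = count-insert base c base-c
    insert⊆f : insert c base ⊆ᵇ f
    insert⊆f x p = [ base⊆f x , (λ x=c → subst (λ y → f y ≡ true) (sym (==-sound x=c)) (∧-elimˡ (f c) c-new)) ]′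
                     (∨-elim (base x) p)
    room′ : countFin (insert c base) + m ≤ countFin f
    room′ = subst (_≤ countFin f) (trans (+-suc _ m) (cong (_+ m) (sym grows))) room
    enlarge : ∃[ g ] insert c base ⊆ᵇ g × g ⊆ᵇ f × countFin g ≡ countFin (insert c base) + m →
              ∃[ g ] base ⊆ᵇ g × g ⊆ᵇ f × countFin g ≡ countFin base + suc m
    enlarge (g , insert⊆g , g⊆f , |g|) =
      g , (λ x p → insert⊆g x (∨-introˡ _ p)) , g⊆f , trans |g| (trans (cong (_+ m) grows) (sym (+-suc _ m)))

anyV-intro : ∀ {k} (f : V k → Bool) z → f z ≡ true → anyV f ≡ true
anyV-intro f (top , i) p = ∨-introˡ _ (anyFin-intro (λ j → f (top , j)) i p)
anyV-intro f (mid , i) p = ∨-introʳ (anyFin (λ j → f (top , j))) (∨-introˡ _ (anyFin-intro (λ j → f (mid , j)) i p))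
anyV-intro f (bot , i) p = ∨-introʳ (anyFin (λ j → f (top , j)))
                             (∨-introʳ (anyFin (λ j → f (mid , j))) (anyFin-intro (λ j → f (bot , j)) i p))

anyV-elim : ∀ {k} (f : V k → Bool) → anyV f ≡ true → ∃[ z ] f z ≡ true
anyV-elim f p with ∨-elim (anyFin (λ i → f (top , i))) p
... | inj₁ t = let i , q = anyFin-elim _ t in (top , i) , q
... | inj₂ mb with ∨-elim (anyFin (λ i → f (mid , i))) mb
...   | inj₁ m = let i , q = anyFin-elim _ m in (mid , i) , q
...   | inj₂ b = let i , q = anyFin-elim _ b in (bot , i) , q

anyV-cong : ∀ {k} {f g : V k → Bool} → (∀ z → f z ≡ g z) → anyV f ≡ anyV g
anyV-cong h = cong₂ _∨_ (anyFin-cong (λ i → h (top , i)))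
                        (cong₂ _∨_ (anyFin-cong (λ i → h (mid , i))) (anyFin-cong (λ i → h (bot , i))))

searchV : ∀ {k} (f : V k → Bool) → (∀ z → f z ≡ false) ⊎ ∃[ z ] f z ≡ true
searchV f with search (λ i → f (top , i)) | search (λ i → f (mid , i)) | search (λ i → f (bot , i))
... | inj₂ (i , p) | _            | _            = inj₂ (_ , p)
... | inj₁ _       | inj₂ (i , p) | _            = inj₂ (_ , p)
... | inj₁ _       | inj₁ _       | inj₂ (i , p) = inj₂ (_ , p)
... | inj₁ t       | inj₁ m       | inj₁ b       = inj₁ λ { (top , i) → t i ; (mid , i) → m i ; (bot , i) → b i }

countV : ∀ {k} → (V k → Bool) → ℕ
countV f = countFin (λ i → f (top , i)) + countFin (λ i → f (mid , i)) + countFin (λ i → f (bot , i))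

countV-strict : ∀ {k} {f g : V k → Bool} → f ⊆ᵇ g → ∀ z → f z ≡ false → g z ≡ true → countV f < countV g
countV-strict f⊆g (top , j) fz gz =
  +-mono-<-≤ (+-mono-<-≤ (count-strict (λ i → f⊆g (top , i)) j fz gz) (count-mono (λ i → f⊆g (mid , i))))
             (count-mono (λ i → f⊆g (bot , i)))
countV-strict f⊆g (mid , j) fz gz =
  +-mono-<-≤ (+-mono-≤-< (count-mono (λ i → f⊆g (top , i))) (count-strict (λ i → f⊆g (mid , i)) j fz gz))
             (count-mono (λ i → f⊆g (bot , i)))
countV-strict f⊆g (bot , j) fz gz =
  +-mono-≤-< (+-mono-≤ (count-mono (λ i → f⊆g (top , i))) (count-mono (λ i → f⊆g (mid , i))))
             (count-strict (λ i → f⊆g (bot , i)) j fz gz)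

countV-< : ∀ {k} (f : V k → Bool) z → f z ≡ false → countV f < 3 * k
countV-< {k} f z fz = <-≤-trans (countV-strict {f = f} {λ _ → true} (λ _ _ → refl) z fz refl) all≤3k
  where
    all≤3k : countV {k} (λ _ → true) ≤ 3 * k
    all≤3k = ≤-trans (+-mono-≤ (+-mono-≤ (count-≤ {k} (λ _ → true)) (count-≤ {k} (λ _ → true))) (count-≤ {k} (λ _ → true)))
                     (≤-reflexive (trans (+-assoc k k k) (cong (k +_) (cong (k +_) (sym (+-identityʳ k))))))

Link : ∀ {k} → Diagram k → Diagram k → V k → V k → Set
Link π γ = Holds (edge π γ)

Path : ∀ {k} → Diagram k → Diagram k → V k → V k → Set
Path π γ = Star (Link π γ)

==V-sound : ∀ {k} {x y : V k} → x ==V y ≡ true → x ≡ y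
==V-sound {x = top , a} {top , b} p = cong (top ,_) (==-sound p)
==V-sound {x = mid , a} {mid , b} p = cong (mid ,_) (==-sound p)
==V-sound {x = bot , a} {bot , b} p = cong (bot ,_) (==-sound p)

==V-refl : ∀ {k} (x : V k) → x ==V x ≡ true
==V-refl (top , a) = ==-refl a
==V-refl (mid , a) = ==-refl a
==V-refl (bot , a) = ==-refl a

-- The product as connectivity in the concatenated diagram

module Connectivity {k : ℕ} (π γ : Diagram k) where

  reach-sound : ∀ n {x y} → reach π γ n x y ≡ true → Path π γ x y
  reach-sound zero {x} {y} p with ==V-sound {x = x} {y} p
  ... | refl = ε
  reach-sound (suc n) {x} {y} p with ∨-elim (reach π γ n x y) p
  ... | inj₁ q = reach-sound n q
  ... | inj₂ q = let z , r = anyV-elim (λ w → reach π γ n x w ∧ edge π γ w y) q in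
    reach-sound n (∧-elimˡ (reach π γ n x z) r) ◅◅ (∧-elimʳ (reach π γ n x z) r ◅ ε)

  reach-mono : ∀ {n m} x y → n ≤ m → reach π γ n x y ≡ true → reach π γ m x y ≡ true
  reach-mono {n} {m} x y n≤m p = subst (λ j → reach π γ j x y ≡ true) (m∸n+n≡m n≤m) (go (m ∸ n))
    where
      go : ∀ d → reach π γ (d + n) x y ≡ true
      go zero    = p
      go (suc d) = ∨-introˡ _ (go d)

  reach-snoc : ∀ n {x y z} → reach π γ n x y ≡ true → Link π γ y z → reach π γ (suc n) x z ≡ true
  reach-snoc n {x} {y} {z} p e = ∨-introʳ (reach π γ n x z) (anyV-intro (λ w → reach π γ n x w ∧ edge π γ w z) y (∧-intro p e))

  path-reach : ∀ {x y} → Path π γ x y → ∃[ n ] reach π γ n x y ≡ true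
  path-reach {x} = go zero (==V-refl x)
    where
      go : ∀ n {y z} → reach π γ n x y ≡ true → Path π γ y z → ∃[ m ] reach π γ m x z ≡ true
      go n p ε        = n , p
      go n p (e ◅ es) = go (suc n) (reach-snoc n p e) es

  module _ (x : V k) where

    StableFrom : ℕ → Set
    StableFrom n = ∀ m y → reach π γ (m + n) x y ≡ reach π γ n x y

    stable-from : ∀ n → (∀ y → reach π γ (suc n) x y ≡ reach π γ n x y) → StableFrom n
    stable-from n step zero    y = refl
    stable-from n step (suc m) y =
      trans (cong₂ _∨_ (stable-from n step m y)
                       (anyV-cong λ z → cong (_∧ edge π γ z y) (stable-from n step m z)))
            (step y)

    stable-from-suc : ∀ n → StableFrom n → StableFrom (suc n)
    stable-from-suc n st m y =
      trans (subst (λ j → reach π γ j x y ≡ reach π γ n x y) (sym (+-suc m n)) (st (suc m) y)) (sym (st 1 y))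

    grows-or-stable : ∀ n → n ≤ countV (reach π γ n x) ⊎ StableFrom n
    grows-or-stable zero = inj₁ z≤n
    grows-or-stable (suc n) with grows-or-stable n
    ... | inj₂ st = inj₂ (stable-from-suc n st)
    ... | inj₁ n≤ with searchV (λ y → reach π γ (suc n) x y ∧ not (reach π γ n x y))
    ...   | inj₁ none = inj₂ (stable-from-suc n (stable-from n λ y →
                          ≡-from-true⇔true (λ p → ¬-not λ q → true≢false (trans (sym (∧-intro p (cong not q))) (none y)))
                                           (∨-introˡ _)))
    ...   | inj₂ (y , new) = inj₁ (≤-trans (s≤s n≤) (countV-strict {f = reach π γ n x} {reach π γ (suc n) x} (λ _ → ∨-introˡ _) y
                               (Bool.not-injective (∧-elimʳ (reach π γ (suc n) x y) new))
                               (∧-elimˡ (reach π γ (suc n) x y) new)))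

  -- The reachable set grows at every step until it stalls, and there are only 3k vertices.
  reach-complete : ∀ {x y} → Path π γ x y → reach π γ (3 * k) x y ≡ true
  reach-complete {x} {y} path with grows-or-stable x (3 * k)
  ... | inj₁ full with reach π γ (3 * k) x y in r
  ...   | true  = refl
  ...   | false = ⊥-elim (<⇒≱ (countV-< (reach π γ (3 * k) x) y r) full)
  reach-complete {x} {y} path | inj₂ stable with path-reach path
  ... | n , p with ≤-total n (3 * k)
  ...   | inj₁ n≤3k = reach-mono x y n≤3k p
  ...   | inj₂ 3k≤n = trans (sym (stable (n ∸ 3 * k) y)) (subst (λ j → reach π γ j x y ≡ true) (sym (m∸n+n≡m 3k≤n)) p)

  ·-sound : ∀ x y → (π · γ) x y ≡ true → Path π γ (embed x) (embed y)
  ·-sound x y = reach-sound (3 * k)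

  ·-complete : ∀ x y → Path π γ (embed x) (embed y) → (π · γ) x y ≡ true
  ·-complete x y = reach-complete

module _ {k : ℕ} where

  ≈-isEquivalence : IsEquivalence (_≈_ {k})
  ≈-isEquivalence = record
    { refl  = λ _ _ → refl
    ; sym   = λ d≈e x y → sym (d≈e x y)
    ; trans = λ d≈e e≈f x y → trans (d≈e x y) (e≈f x y) }

  diagramSetoid : Setoid _ _
  diagramSetoid = record { isEquivalence = ≈-isEquivalence }

  open IsEquivalence ≈-isEquivalence public
    using () renaming (refl to ≈-refl; sym to ≈-sym)

  ·-transport : (X Y X′ Y′ : Diagram k) (φ : V k → V k) →
    (∀ {u v} → Link X Y u v → Link X′ Y′ (φ u) (φ v)) →
    ∀ {x y x′ y′} → φ (embed x) ≡ embed x′ → φ (embed y) ≡ embed y′ →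
    (X · Y) x y ≡ true → (X′ · Y′) x′ y′ ≡ true
  ·-transport X Y X′ Y′ φ link {x} {y} {x′} {y′} φx φy p =
    Connectivity.·-complete X′ Y′ x′ y′
      (subst₂ (Path X′ Y′) φx φy (gmap φ link (Connectivity.·-sound X Y x y p)))

  path-invariant : (X Y : Diagram k) (Z : Diagram k) (ψ : V k → Pt k) →
    Reflexive (Holds Z) → Transitive (Holds Z) →
    (∀ {u v} → Link X Y u v → Holds Z (ψ u) (ψ v)) →
    ∀ {u v} → Path X Y u v → Holds Z (ψ u) (ψ v)
  path-invariant X Y Z ψ Z-refl Z-trans link = fold (λ u v → Holds Z (ψ u) (ψ v)) (λ e rest → Z-trans (link e) rest) Z-refl

  edge-cong : ∀ {X Y X′ Y′ : Diagram k} → X ≈ X′ → Y ≈ Y′ → ∀ u v → edge X Y u v ≡ edge X′ Y′ u v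
  edge-cong X≈ Y≈ (top , a) (top , b) = X≈ _ _
  edge-cong X≈ Y≈ (top , a) (mid , b) = X≈ _ _
  edge-cong X≈ Y≈ (top , a) (bot , b) = refl
  edge-cong X≈ Y≈ (mid , a) (top , b) = X≈ _ _
  edge-cong X≈ Y≈ (mid , a) (mid , b) = cong₂ _∨_ (X≈ _ _) (Y≈ _ _)
  edge-cong X≈ Y≈ (mid , a) (bot , b) = Y≈ _ _
  edge-cong X≈ Y≈ (bot , a) (top , b) = refl
  edge-cong X≈ Y≈ (bot , a) (mid , b) = Y≈ _ _
  edge-cong X≈ Y≈ (bot , a) (bot , b) = Y≈ _ _

  ·-cong : ∀ {X Y X′ Y′ : Diagram k} → X ≈ X′ → Y ≈ Y′ → (X · Y) ≈ (X′ · Y′)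
  ·-cong {X} {Y} {X′} {Y′} X≈ Y≈ x y = ≡-from-true⇔true
    (·-transport X Y X′ Y′ id (λ {u} {v} e → trans (sym (edge-cong X≈ Y≈ u v)) e) refl refl)
    (·-transport X′ Y′ X Y id (λ {u} {v} e → trans (edge-cong X≈ Y≈ u v) e) refl refl)

  pointMap : (Fin k → Fin k) → (Fin k → Fin k) → Pt k → Pt k
  pointMap f g (inj₁ a) = inj₁ (f a)
  pointMap f g (inj₂ b) = inj₂ (g b)

  relabel : (Fin k → Fin k) → (Fin k → Fin k) → Diagram k → Diagram k
  relabel f g X x y = X (pointMap f g x) (pointMap f g y)

  relabel-cong : ∀ f g {X Y : Diagram k} → X ≈ Y → relabel f g X ≈ relabel f g Y
  relabel-cong f g X≈Y x y = X≈Y _ _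

  pointMap-∘ : ∀ f g f′ g′ x → pointMap f′ g′ (pointMap f g x) ≡ pointMap (λ a → f′ (f a)) (λ b → g′ (g b)) x
  pointMap-∘ f g f′ g′ (inj₁ a) = refl
  pointMap-∘ f g f′ g′ (inj₂ b) = refl

  relabel-∘ : ∀ f g f′ g′ (X : Diagram k) →
    relabel f g (relabel f′ g′ X) ≈ relabel (λ a → f′ (f a)) (λ b → g′ (g b)) X
  relabel-∘ f g f′ g′ X x y = cong₂ X (pointMap-∘ f g f′ g′ x) (pointMap-∘ f g f′ g′ y)

  relabel-id : ∀ {f g} (X : Diagram k) → (∀ a → f a ≡ a) → (∀ b → g b ≡ b) → relabel f g X ≈ X
  relabel-id {f} {g} X f≗id g≗id x y = cong₂ X (fixed x) (fixed y)
    where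
      fixed : ∀ x → pointMap f g x ≡ x
      fixed (inj₁ a) = cong inj₁ (f≗id a)
      fixed (inj₂ b) = cong inj₂ (g≗id b)

  vertexMap : (Fin k → Fin k) → (Fin k → Fin k) → V k → V k
  vertexMap f g (top , a) = top , f a
  vertexMap f g (mid , a) = mid , a
  vertexMap f g (bot , a) = bot , g a

  vertexMap-embed : ∀ f g x → vertexMap f g (embed x) ≡ embed (pointMap f g x)
  vertexMap-embed f g (inj₁ a) = refl
  vertexMap-embed f g (inj₂ b) = refl

  vertexMap-inverse : ∀ {f g f′ g′} → (∀ a → f (f′ a) ≡ a) → (∀ b → g (g′ b) ≡ b) →
    ∀ u → vertexMap f g (vertexMap f′ g′ u) ≡ u
  vertexMap-inverse ff′ gg′ (top , a) = cong (top ,_) (ff′ a)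
  vertexMap-inverse ff′ gg′ (mid , a) = refl
  vertexMap-inverse ff′ gg′ (bot , a) = cong (bot ,_) (gg′ a)

  edge-relabel : ∀ f g (X Y : Diagram k) u v →
    edge (relabel f id X) (relabel id g Y) u v ≡ edge X Y (vertexMap f g u) (vertexMap f g v)
  edge-relabel f g X Y (top , a) (top , b) = refl
  edge-relabel f g X Y (top , a) (mid , b) = refl
  edge-relabel f g X Y (top , a) (bot , b) = refl
  edge-relabel f g X Y (mid , a) (top , b) = refl
  edge-relabel f g X Y (mid , a) (mid , b) = refl
  edge-relabel f g X Y (mid , a) (bot , b) = refl
  edge-relabel f g X Y (bot , a) (top , b) = refl
  edge-relabel f g X Y (bot , a) (mid , b) = refl
  edge-relabel f g X Y (bot , a) (bot , b) = refl

  -- Relabelling the outer rows of the factors relabels the product, because the middle row is untouched.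
  ·-relabel : (π ρ : Permutation′ k) (X Y : Diagram k) →
    (relabel (π ⟨$⟩ʳ_) id X · relabel id (ρ ⟨$⟩ʳ_) Y) ≈ relabel (π ⟨$⟩ʳ_) (ρ ⟨$⟩ʳ_) (X · Y)
  ·-relabel π ρ X Y x y = ≡-from-true⇔true
    (·-transport X′ Y′ X Y (vertexMap f g) (λ {u} {v} e → trans (sym (edge-relabel f g X Y u v)) e)
      (vertexMap-embed f g x) (vertexMap-embed f g y))
    (·-transport X Y X′ Y′ (vertexMap f⁻ g⁻)
      (λ {u} {v} e → trans (edge-relabel f g X Y (vertexMap f⁻ g⁻ u) (vertexMap f⁻ g⁻ v))
                       (subst₂ (Link X Y) (sym (back u)) (sym (back v)) e))
      (there-and-back x) (there-and-back y))
    where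
      f = π ⟨$⟩ʳ_
      g = ρ ⟨$⟩ʳ_
      f⁻ = π ⟨$⟩ˡ_
      g⁻ = ρ ⟨$⟩ˡ_
      X′ = relabel f id X
      Y′ = relabel id g Y
      back : ∀ u → vertexMap f g (vertexMap f⁻ g⁻ u) ≡ u
      back = vertexMap-inverse (λ _ → inverseʳ π) (λ _ → inverseʳ ρ)
      there-and-back : ∀ x → vertexMap f⁻ g⁻ (embed (pointMap f g x)) ≡ embed x
      there-and-back (inj₁ a) = cong (top ,_) (inverseˡ π)
      there-and-back (inj₂ b) = cong (bot ,_) (inverseˡ ρ)

  module _ (X : Diagram k) (X-refl : Reflexive (Holds X)) (X-trans : Transitive (Holds X)) where

    perm-· : (σ : Permutation′ k) → (perm σ · X) ≈ relabel (σ ⟨$⟩ˡ_) id X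
    perm-· σ x y = ≡-from-true⇔true
      (λ p → subst₂ (Holds X) (ψ-embed x) (ψ-embed y)
               (path-invariant (perm σ) X X ψ X-refl X-trans (λ {u} {v} → link u v) (Connectivity.·-sound (perm σ) X x y p)))
      (λ p → Connectivity.·-complete (perm σ) X x y (enter x ◅◅ (cross x y p ◅ leave y)))
      where
        ψ : V k → Pt k
        ψ (top , a) = inj₁ (σ ⟨$⟩ˡ a)
        ψ (mid , a) = inj₁ a
        ψ (bot , a) = inj₂ a

        ψ-embed : ∀ x → ψ (embed x) ≡ pointMap (σ ⟨$⟩ˡ_) id x
        ψ-embed (inj₁ a) = refl
        ψ-embed (inj₂ b) = refl

        link : ∀ u v → Link (perm σ) X u v → Holds X (ψ u) (ψ v)
        link (top , a) (top , b) e rewrite ==-sound e = X-refl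
        link (top , a) (mid , b) e rewrite ==-sound e | inverseˡ σ {b} = X-refl
        link (mid , a) (top , b) e rewrite ==-sound e | inverseˡ σ {a} = X-refl
        link (mid , a) (mid , b) e with ∨-elim (a == b) e
        ... | inj₁ a=b rewrite ==-sound a=b = X-refl
        ... | inj₂ Xab = Xab
        link (mid , a) (bot , b) e = e
        link (bot , a) (mid , b) e = e
        link (bot , a) (bot , b) e = e

        port : Pt k → V k
        port (inj₁ a) = mid , σ ⟨$⟩ˡ a
        port (inj₂ b) = bot , b

        enter : ∀ x → Path (perm σ) X (embed x) (port x)
        enter (inj₁ a) = ==-complete (sym (inverseʳ σ)) ◅ ε
        enter (inj₂ b) = ε

        leave : ∀ y → Path (perm σ) X (port y) (embed y)
        leave (inj₁ a) = ==-complete (sym (inverseʳ σ)) ◅ ε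
        leave (inj₂ b) = ε

        cross : ∀ x y → relabel (σ ⟨$⟩ˡ_) id X x y ≡ true → Link (perm σ) X (port x) (port y)
        cross (inj₁ a) (inj₁ b) p = ∨-introʳ ((σ ⟨$⟩ˡ a) == (σ ⟨$⟩ˡ b)) p
        cross (inj₁ a) (inj₂ b) p = p
        cross (inj₂ a) (inj₁ b) p = p
        cross (inj₂ a) (inj₂ b) p = p

    ·-perm : (τ : Permutation′ k) → (X · perm τ) ≈ relabel id (τ ⟨$⟩ʳ_) X
    ·-perm τ x y = ≡-from-true⇔true
      (λ p → subst₂ (Holds X) (ψ-embed x) (ψ-embed y)
               (path-invariant X (perm τ) X ψ X-refl X-trans (λ {u} {v} → link u v) (Connectivity.·-sound X (perm τ) x y p)))
      (λ p → Connectivity.·-complete X (perm τ) x y (enter x ◅◅ (cross x y p ◅ leave y)))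
      where
        ψ : V k → Pt k
        ψ (top , a) = inj₁ a
        ψ (mid , a) = inj₂ a
        ψ (bot , a) = inj₂ (τ ⟨$⟩ʳ a)

        ψ-embed : ∀ x → ψ (embed x) ≡ pointMap id (τ ⟨$⟩ʳ_) x
        ψ-embed (inj₁ a) = refl
        ψ-embed (inj₂ b) = refl

        link : ∀ u v → Link X (perm τ) u v → Holds X (ψ u) (ψ v)
        link (top , a) (top , b) e = e
        link (top , a) (mid , b) e = e
        link (mid , a) (top , b) e = e
        link (mid , a) (mid , b) e with ∨-elim (X (inj₂ a) (inj₂ b)) e
        ... | inj₁ Xab = Xab
        ... | inj₂ a=b rewrite ==-sound a=b = X-refl
        link (mid , a) (bot , b) e rewrite ==-sound e = X-refl
        link (bot , a) (mid , b) e rewrite ==-sound e = X-refl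
        link (bot , a) (bot , b) e rewrite ==-sound e = X-refl

        port : Pt k → V k
        port (inj₁ a) = top , a
        port (inj₂ b) = mid , τ ⟨$⟩ʳ b

        enter : ∀ x → Path X (perm τ) (embed x) (port x)
        enter (inj₁ a) = ε
        enter (inj₂ b) = ==-refl (τ ⟨$⟩ʳ b) ◅ ε

        leave : ∀ y → Path X (perm τ) (port y) (embed y)
        leave (inj₁ a) = ε
        leave (inj₂ b) = ==-refl (τ ⟨$⟩ʳ b) ◅ ε

        cross : ∀ x y → relabel id (τ ⟨$⟩ʳ_) X x y ≡ true → Link X (perm τ) (port x) (port y)
        cross (inj₁ a) (inj₁ b) p = p
        cross (inj₁ a) (inj₂ b) p = p
        cross (inj₂ a) (inj₁ b) p = p
        cross (inj₂ a) (inj₂ b) p = ∨-introˡ ((τ ⟨$⟩ʳ a) == (τ ⟨$⟩ʳ b)) p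

-- Idempotents of set partitions and their joins

FinRel : ℕ → Set
FinRel k = Fin k → Fin k → Bool

module _ {k : ℕ} where

  idx : Pt k → Fin k
  idx (inj₁ a) = a
  idx (inj₂ a) = a

  -- The idempotent of 𝒰_k whose blocks are A ∪ Ā for the blocks A of the partition of [k].
  idem : FinRel k → Diagram k
  idem A x y = A (idx x) (idx y)

  conjugate : FinRel k → (Fin k → Fin k) → FinRel k
  conjugate A f a b = A (f a) (f b)

  relabel-idem : ∀ f (A : FinRel k) → relabel f f (idem A) ≈ idem (conjugate A f)
  relabel-idem f A x y = cong₂ A (idx-pointMap x) (idx-pointMap y)
    where
      idx-pointMap : ∀ x → idx (pointMap f f x) ≡ f (idx x)
      idx-pointMap (inj₁ a) = refl
      idx-pointMap (inj₂ b) = refl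

  Chain : FinRel k → FinRel k → Fin k → Fin k → Set
  Chain A B = Star (Holds A ∪ᴿ Holds B)

  -- The equivalence relation generated by A ∪ B (see join⇒chain and chain⇒join), read off the
  -- product of the two idempotents.
  join : FinRel k → FinRel k → FinRel k
  join A B a b = (idem A · idem B) (inj₁ a) (inj₁ b)

  module _ (A B : FinRel k) (A-refl : Reflexive (Holds A)) (B-refl : Reflexive (Holds B)) where

    private
      step : ∀ {u v} → Link (idem A) (idem B) u v → (Holds A ∪ᴿ Holds B) (proj₂ u) (proj₂ v)
      step {top , a} {top , b} e = inj₁ e
      step {top , a} {mid , b} e = inj₁ e
      step {mid , a} {top , b} e = inj₁ e
      step {mid , a} {mid , b} e = ∨-elim (A a b) e
      step {mid , a} {bot , b} e = inj₂ e
      step {bot , a} {mid , b} e = inj₂ e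
      step {bot , a} {bot , b} e = inj₂ e

      unstep : ∀ {a b} → (Holds A ∪ᴿ Holds B) a b → Link (idem A) (idem B) (mid , a) (mid , b)
      unstep {a} {b} (inj₁ Aab) = ∨-introˡ (B a b) Aab
      unstep {a} {b} (inj₂ Bab) = ∨-introʳ (A a b) Bab

      to-mid : ∀ x → Path (idem A) (idem B) (embed x) (mid , idx x)
      to-mid (inj₁ a) = A-refl ◅ ε
      to-mid (inj₂ a) = B-refl ◅ ε

      from-mid : ∀ x → Path (idem A) (idem B) (mid , idx x) (embed x)
      from-mid (inj₁ a) = A-refl ◅ ε
      from-mid (inj₂ a) = B-refl ◅ ε

      embed-idx : ∀ x → proj₂ (embed x) ≡ idx x
      embed-idx (inj₁ a) = refl
      embed-idx (inj₂ a) = refl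

      ·-chain : ∀ x y → (idem A · idem B) x y ≡ true → Chain A B (idx x) (idx y)
      ·-chain x y p = subst₂ (Chain A B) (embed-idx x) (embed-idx y)
                        (gmap proj₂ (λ {u} {v} → step {u} {v}) (Connectivity.·-sound (idem A) (idem B) x y p))

      chain-· : ∀ x y → Chain A B (idx x) (idx y) → (idem A · idem B) x y ≡ true
      chain-· x y c = Connectivity.·-complete (idem A) (idem B) x y (to-mid x ◅◅ gmap (mid ,_) unstep c ◅◅ from-mid y)

    join⇒chain : ∀ {a b} → join A B a b ≡ true → Chain A B a b
    join⇒chain = ·-chain (inj₁ _) (inj₁ _)

    chain⇒join : ∀ {a b} → Chain A B a b → join A B a b ≡ true
    chain⇒join = chain-· (inj₁ _) (inj₁ _)

    idem-·-idem : (idem A · idem B) ≈ idem (join A B)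
    idem-·-idem x y = ≡-from-true⇔true (λ p → chain⇒join (·-chain x y p)) (λ p → chain-· x y (join⇒chain p))

    ⊆-joinˡ : A ⊆ʳ join A B
    ⊆-joinˡ a b Aab = chain⇒join (inj₁ Aab ◅ ε)

    ⊆-joinʳ : B ⊆ʳ join A B
    ⊆-joinʳ a b Bab = chain⇒join (inj₂ Bab ◅ ε)

  chain-least : ∀ {A B R : FinRel k} → IsEquivalence (Holds R) → A ⊆ʳ R → B ⊆ʳ R → ∀ {a b} → Chain A B a b → Holds R a b
  chain-least {A} {B} {R} R-eq A⊆R B⊆R = fold (Holds R) link (IsEquivalence.refl R-eq)
    where
      link : ∀ {a b c} → (Holds A ∪ᴿ Holds B) a b → Holds R b c → Holds R a c
      link (inj₁ Aab) rest = IsEquivalence.trans R-eq (A⊆R _ _ Aab) rest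
      link (inj₂ Bab) rest = IsEquivalence.trans R-eq (B⊆R _ _ Bab) rest

  module _ (A B : FinRel k) (A-eq : IsEquivalence (Holds A)) (B-eq : IsEquivalence (Holds B)) where
    private
      module A = IsEquivalence A-eq
      module B = IsEquivalence B-eq

    join-isEquivalence : IsEquivalence (Holds (join A B))
    join-isEquivalence = record
      { refl  = chain⇒join A B A.refl B.refl ε
      ; sym   = λ p → chain⇒join A B A.refl B.refl (reverse (λ { (inj₁ q) → inj₁ (A.sym q) ; (inj₂ q) → inj₂ (B.sym q) })
                                                        (join⇒chain A B A.refl B.refl p))
      ; trans = λ p q → chain⇒join A B A.refl B.refl (join⇒chain A B A.refl B.refl p ◅◅ join⇒chain A B A.refl B.refl q) }

    join-least : ∀ {R : FinRel k} → IsEquivalence (Holds R) → A ⊆ʳ R → B ⊆ʳ R → join A B ⊆ʳ R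
    join-least R-eq A⊆R B⊆R a b p = chain-least R-eq A⊆R B⊆R (join⇒chain A B A.refl B.refl p)

    join-comm : idem (join B A) ≈ idem (join A B)
    join-comm x y = ≡-from-true⇔true
      (λ p → chain⇒join A B A.refl B.refl (swap-chain (join⇒chain B A B.refl A.refl p)))
      (λ p → chain⇒join B A B.refl A.refl (swap-chain (join⇒chain A B A.refl B.refl p)))
      where
        swap-chain : ∀ {C D : FinRel k} {a b} → Chain C D a b → Chain D C a b
        swap-chain = gmap id (λ { (inj₁ p) → inj₂ p ; (inj₂ p) → inj₁ p })

blockSize : ∀ {k} → FinRel k → Fin k → ℕ
blockSize X a = countFin (X a)

SmallerBlock : ∀ {k} → FinRel k → FinRel k → Fin k → Set
SmallerBlock X Y a = ∃[ c ] 2 ≤ blockSize X c × blockSize X c ≤ blockSize Y a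

smaller-block? : ∀ {k} (X Y : FinRel k) a → Dec (SmallerBlock X Y a)
smaller-block? X Y a = Fin.any? (λ c → (2 ≤? blockSize X c) ×-dec (blockSize X c ≤? blockSize Y a))

conjugate-⊆ : ∀ {k} {X R : FinRel k} → IsEquivalence (Holds R) → X ⊆ʳ R →
  ∀ f → (∀ x → Holds R x (f x)) → conjugate X f ⊆ʳ R
conjugate-⊆ R-eq X⊆R f within u v Xfufv = R.trans (within u) (R.trans (X⊆R _ _ Xfufv) (R.sym (within v)))
  where module R = IsEquivalence R-eq

module _ {k : ℕ} where

  transpose-at-i : ∀ (i j : Fin k) → transpose i j ⟨$⟩ʳ i ≡ j
  transpose-at-i i j rewrite dec-true (i ≟ i) refl = refl

  transpose-at-j : ∀ (i j : Fin k) → j ≢ i → transpose i j ⟨$⟩ʳ j ≡ i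
  transpose-at-j i j j≢i rewrite dec-false (j ≟ i) j≢i | dec-true (j ≟ j) refl = refl

  transpose-elsewhere : ∀ (i j x : Fin k) → x ≢ i → x ≢ j → transpose i j ⟨$⟩ʳ x ≡ x
  transpose-elsewhere i j x x≢i x≢j rewrite dec-false (x ≟ i) x≢i | dec-false (x ≟ j) x≢j = refl

  data TransposeView (i j x : Fin k) : Set where
    at-i      : x ≡ i → TransposeView i j x
    at-j      : x ≢ i → x ≡ j → TransposeView i j x
    elsewhere : x ≢ i → x ≢ j → TransposeView i j x

  transpose-view : ∀ i j x → TransposeView i j x
  transpose-view i j x with x ≟ i | x ≟ j
  ... | yes x≡i | _       = at-i x≡i
  ... | no x≢i  | yes x≡j = at-j x≢i x≡j
  ... | no x≢i  | no x≢j  = elsewhere x≢i x≢j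

  transpose-involutive : ∀ (i j x : Fin k) → transpose i j ⟨$⟩ʳ (transpose i j ⟨$⟩ʳ x) ≡ x
  transpose-involutive i j x with transpose-view i j x
  ... | at-i refl with i ≟ j
  ...   | yes refl = trans (cong (transpose i i ⟨$⟩ʳ_) (transpose-at-i i i)) (transpose-at-i i i)
  ...   | no i≢j   = trans (cong (transpose i j ⟨$⟩ʳ_) (transpose-at-i i j)) (transpose-at-j i j (λ j≡i → i≢j (sym j≡i)))
  transpose-involutive i j x | at-j x≢i refl =
    trans (cong (transpose i j ⟨$⟩ʳ_) (transpose-at-j i x x≢i)) (transpose-at-i i x)
  transpose-involutive i j x | elsewhere x≢i x≢j =
    trans (cong (transpose i j ⟨$⟩ʳ_) (transpose-elsewhere i j x x≢i x≢j)) (transpose-elsewhere i j x x≢i x≢j)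

  transpose-within : ∀ {R : FinRel k} → IsEquivalence (Holds R) → ∀ {i j} → Holds R i j →
    ∀ x → Holds R x (transpose i j ⟨$⟩ʳ x)
  transpose-within {R} R-eq {i} {j} Rij x with transpose-view i j x
  ... | at-i refl           = subst (Holds R x) (sym (transpose-at-i x j)) Rij
  ... | at-j x≢i refl       = subst (Holds R x) (sym (transpose-at-j i x x≢i)) (IsEquivalence.sym R-eq Rij)
  ... | elsewhere x≢i x≢j   = subst (Holds R x) (sym (transpose-elsewhere i j x x≢i x≢j)) (IsEquivalence.refl R-eq)

-- Factorisation of uniform block permutations

<ᵇ-true : ∀ {m n} → m < n → (m <ᵇ n) ≡ true
<ᵇ-true m<n = Equivalence.to Bool.T-≡ (<⇒<ᵇ m<n)

<ᵇ-true⁻¹ : ∀ {m n} → (m <ᵇ n) ≡ true → m < n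
<ᵇ-true⁻¹ {m} {n} p = <ᵇ⇒< m n (Equivalence.from Bool.T-≡ p)

InU-isEquivalence : ∀ {k} {d : Diagram k} → InU k d → IsEquivalence (Holds d)
InU-isEquivalence d∈U = record
  { refl  = refl' _
  ; sym   = sym' _ _
  ; trans = trans' _ _ _ }
  where open InU d∈U

≡-between-related : ∀ {A : Set} {R : A → A → Bool} → IsEquivalence (Holds R) →
  ∀ {x x′ y y′} → Holds R x x′ → Holds R y y′ → R x y ≡ R x′ y′
≡-between-related R-eq xx′ yy′ = ≡-from-true⇔true
  (λ xy → R.trans (R.sym xx′) (R.trans xy yy′))
  (λ x′y′ → R.trans xx′ (R.trans x′y′ (R.sym yy′)))
  where module R = IsEquivalence R-eq

-- Every uniform block permutation is an idempotent with one of its rows relabelled.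
module Factorisation {k : ℕ} {d : Diagram k} (d∈U : InU k d) where

  open InU d∈U

  topRel bottomRel : FinRel k
  topRel    a b = d (inj₁ a) (inj₁ b)
  bottomRel a b = d (inj₂ a) (inj₂ b)

  d-eq : IsEquivalence (Holds d)
  d-eq = InU-isEquivalence d∈U

  topRel-isEquivalence : IsEquivalence (Holds topRel)
  topRel-isEquivalence = record { refl = refl' _ ; sym = sym' _ _ ; trans = trans' _ _ _ }

  bottomRel-isEquivalence : IsEquivalence (Holds bottomRel)
  bottomRel-isEquivalence = record { refl = refl' _ ; sym = sym' _ _ ; trans = trans' _ _ _ }

  record Matching (n : ℕ) : Set where
    field
      π       : Permutation′ k
      matches : ∀ a → toℕ a < n → d (inj₁ a) (inj₂ (π ⟨$⟩ʳ a)) ≡ true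

  module _ {n} (M : Matching n) (a₀ : Fin k) (a₀≡n : toℕ a₀ ≡ n) where

    open Matching M

    private
      top-of-block bottom-of-block matched-top : Fin k → Bool
      top-of-block a    = d (inj₁ a₀) (inj₁ a)
      bottom-of-block j = d (inj₁ a₀) (inj₂ j)
      matched-top a     = top-of-block a ∧ (toℕ a <ᵇ n)

      matched-top<top : countFin matched-top < countFin top-of-block
      matched-top<top = count-strict {f = matched-top} {top-of-block} (λ a → ∧-elimˡ (top-of-block a)) a₀
        (¬-not λ p → <-irrefl a₀≡n (<ᵇ-true⁻¹ (∧-elimʳ (top-of-block a₀) p)))
        (refl' _)

    -- If every bottom point of the block of a₀ were already matched, the block would have fewer
    -- bottom than top points, as a₀ itself is still unmatched.
    fresh-partner : ∃[ j ] d (inj₁ a₀) (inj₂ j) ≡ true × ¬ toℕ (π ⟨$⟩ˡ j) < n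
    fresh-partner with search (λ j → bottom-of-block j ∧ not (toℕ (π ⟨$⟩ˡ j) <ᵇ n))
    ... | inj₂ (j , p) = j , ∧-elimˡ _ p , λ lt → true≢false (trans (sym (∧-elimʳ _ p)) (cong not (<ᵇ-true lt)))
    ... | inj₁ none = ⊥-elim (<-irrefl refl (≤-<-trans bottom≤matched-top
                        (<-≤-trans matched-top<top (≤-reflexive (uniform (inj₁ a₀))))))
      where
        bottom⊆matched : bottom-of-block ⊆ᵇ (λ j → matched-top (π ⟨$⟩ˡ j))
        bottom⊆matched j in-block = ∧-intro (trans' _ _ _ in-block (sym' _ _ matched-partner)) matched
          where
            matched : (toℕ (π ⟨$⟩ˡ j) <ᵇ n) ≡ true
            matched = ¬-not λ q → true≢false (trans (sym (∧-intro in-block (cong not q))) (none j))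
            matched-partner : d (inj₁ (π ⟨$⟩ˡ j)) (inj₂ j) ≡ true
            matched-partner = subst (λ i → d (inj₁ (π ⟨$⟩ˡ j)) (inj₂ i) ≡ true) (inverseʳ π)
                                    (matches _ (<ᵇ-true⁻¹ matched))
        bottom≤matched-top : countFin bottom-of-block ≤ countFin matched-top
        bottom≤matched-top = ≤-trans (count-mono bottom⊆matched) (≤-reflexive (count-permute matched-top (flip π)))

  extend : ∀ {n} → n < k → Matching n → Matching (suc n)
  extend {n} n<k M = record { π = π ∘ₚ transpose (π ⟨$⟩ʳ a₀) j ; matches = matches′ }
    where
      open Matching M
      a₀ = fromℕ< n<k
      a₀≡n : toℕ a₀ ≡ n
      a₀≡n = Fin.toℕ-fromℕ< n<k
      partner = fresh-partner M a₀ a₀≡n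
      j = proj₁ partner
      matches′ : ∀ a → toℕ a < suc n → d (inj₁ a) (inj₂ (transpose (π ⟨$⟩ʳ a₀) j ⟨$⟩ʳ (π ⟨$⟩ʳ a))) ≡ true
      matches′ a a<1+n with toℕ a ℕ.≟ n
      ... | yes a≡n rewrite Fin.toℕ-injective (trans a≡n (sym a₀≡n)) =
              subst (λ i → d (inj₁ a₀) (inj₂ i) ≡ true) (sym (transpose-at-i (π ⟨$⟩ʳ a₀) j)) (proj₁ (proj₂ partner))
      ... | no a≢n = subst (λ i → d (inj₁ a) (inj₂ i) ≡ true) (sym (transpose-elsewhere (π ⟨$⟩ʳ a₀) j (π ⟨$⟩ʳ a) πa≢πa₀ πa≢j)) (matches a a<n)
        where
          a<n = ≤∧≢⇒< (≤-pred a<1+n) a≢n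
          πa≢πa₀ : π ⟨$⟩ʳ a ≢ π ⟨$⟩ʳ a₀
          πa≢πa₀ eq = a≢n (trans (cong toℕ (trans (sym (inverseˡ π)) (trans (cong (π ⟨$⟩ˡ_) eq) (inverseˡ π)))) a₀≡n)
          πa≢j : π ⟨$⟩ʳ a ≢ j
          πa≢j eq = proj₂ (proj₂ partner) (subst (λ i → toℕ i < n) (trans (sym (inverseˡ π)) (cong (π ⟨$⟩ˡ_) eq)) a<n)

  matching : Matching k
  matching = build k ≤-refl
    where
      build : ∀ n → n ≤ k → Matching n
      build zero    _   = record { π = Perm.id ; matches = λ _ () }
      build (suc n) n<k = extend n<k (build n (≤-trans (n≤1+n n) n<k))

  open Matching matching public using (π; matches)

  bottom-factorisation : d ≈ relabel (π ⟨$⟩ʳ_) id (idem bottomRel)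
  bottom-factorisation x y = ≡-between-related d-eq (to-bottom x) (to-bottom y)
    where
      to-bottom : ∀ x → Holds d x (inj₂ (idx (pointMap (π ⟨$⟩ʳ_) id x)))
      to-bottom (inj₁ a) = matches a (Fin.toℕ<n a)
      to-bottom (inj₂ b) = refl' _

  top-factorisation : d ≈ relabel id (π ⟨$⟩ˡ_) (idem topRel)
  top-factorisation x y = ≡-between-related d-eq (to-top x) (to-top y)
    where
      to-top : ∀ x → Holds d x (inj₁ (idx (pointMap id (π ⟨$⟩ˡ_) x)))
      to-top (inj₁ a) = refl' _
      to-top (inj₂ b) = sym' _ _ (subst (λ i → d (inj₁ (π ⟨$⟩ˡ b)) (inj₂ i) ≡ true) (inverseʳ π)
                                        (matches (π ⟨$⟩ˡ b) (Fin.toℕ<n _)))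

module _ {k : ℕ} {d e : Diagram k} (d∈U : InU k d) (e∈U : InU k e) where

  private
    module Fd = Factorisation d∈U
    module Fe = Factorisation e∈U

  ·-factorisation : (d · e) ≈ relabel (Fd.π ⟨$⟩ʳ_) (Fe.π ⟨$⟩ˡ_) (idem (join Fd.bottomRel Fe.topRel))
  ·-factorisation = begin
    d · e                                                               ≈⟨ ·-cong Fd.bottom-factorisation Fe.top-factorisation ⟩
    relabel (Fd.π ⟨$⟩ʳ_) id (idem P) · relabel id (Fe.π ⟨$⟩ˡ_) (idem Q)  ≈⟨ ·-relabel Fd.π (flip Fe.π) (idem P) (idem Q) ⟩
    relabel (Fd.π ⟨$⟩ʳ_) (Fe.π ⟨$⟩ˡ_) (idem P · idem Q)                  ≈⟨ relabel-cong _ _ (idem-·-idem P Q P.refl Q.refl) ⟩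
    relabel (Fd.π ⟨$⟩ʳ_) (Fe.π ⟨$⟩ˡ_) (idem (join P Q))                  ∎
    where
      open SetoidReasoning diagramSetoid
      P = Fd.bottomRel
      Q = Fe.topRel
      module P = IsEquivalence Fd.bottomRel-isEquivalence
      module Q = IsEquivalence Fe.topRel-isEquivalence

module SubmonoidContainingSym {k : ℕ} (S : Subset k) (S-sub : IsSubmonoid k S) (S-sym : ContainsSym k S) where

  open IsSubmonoid S-sub

  relabel-∈ : ∀ {D : Diagram k} → Reflexive (Holds D) → Transitive (Holds D) → (π ρ : Permutation′ k) →
    S D → S (relabel (π ⟨$⟩ʳ_) (ρ ⟨$⟩ʳ_) D)
  relabel-∈ {D} D-refl D-trans π ρ D∈S = respects relabelled (closed (S-sym (flip π)) (closed D∈S (S-sym ρ)))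
    where
      f = π ⟨$⟩ʳ_
      g = ρ ⟨$⟩ʳ_
      relabelled : (perm (flip π) · (D · perm ρ)) ≈ relabel f g D
      relabelled = begin
        perm (flip π) · (D · perm ρ)       ≈⟨ ·-cong {X = perm (flip π)} ≈-refl (·-perm D D-refl D-trans ρ) ⟩
        perm (flip π) · relabel id g D     ≈⟨ perm-· (relabel id g D) D-refl
                                                (λ {x} {y} {z} → D-trans {pointMap id g x} {pointMap id g y} {pointMap id g z})
                                                (flip π) ⟩
        relabel f id (relabel id g D)      ≈⟨ relabel-∘ f id id g D ⟩
        relabel f g D                      ∎
        where open SetoidReasoning diagramSetoid

  idem-conjugate-∈ : ∀ {X : FinRel k} → IsEquivalence (Holds X) → (π : Permutation′ k) →
    S (idem X) → S (idem (conjugate X (π ⟨$⟩ʳ_)))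
  idem-conjugate-∈ {X} X-eq π X∈S =
    respects (relabel-idem (π ⟨$⟩ʳ_) X) (relabel-∈ X.refl (λ {x} {y} {z} → X.trans {idx x} {idx y} {idx z}) π π X∈S)
    where module X = IsEquivalence X-eq

  idem-join-∈ : ∀ (A B : FinRel k) → Reflexive (Holds A) → Reflexive (Holds B) →
    S (idem A) → S (idem B) → S (idem (join A B))
  idem-join-∈ A B A-refl B-refl A∈S B∈S = respects (idem-·-idem A B A-refl B-refl) (closed A∈S B∈S)

  bottom-∈ : ∀ {d} (d∈S : S d) → S (idem (Factorisation.bottomRel (⊆U d∈S)))
  bottom-∈ {d} d∈S = respects to-bottom (relabel-∈ D.refl D.trans (flip π) Perm.id d∈S)
    where
      open Factorisation (⊆U d∈S)
      module D = IsEquivalence d-eq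
      to-bottom : relabel (π ⟨$⟩ˡ_) id d ≈ idem bottomRel
      to-bottom = begin
        relabel (π ⟨$⟩ˡ_) id d                                 ≈⟨ relabel-cong _ _ bottom-factorisation ⟩
        relabel (π ⟨$⟩ˡ_) id (relabel (π ⟨$⟩ʳ_) id (idem bottomRel)) ≈⟨ relabel-∘ _ _ _ _ (idem bottomRel) ⟩
        relabel (λ a → π ⟨$⟩ʳ (π ⟨$⟩ˡ a)) id (idem bottomRel)      ≈⟨ relabel-id (idem bottomRel) (λ _ → inverseʳ π) (λ _ → refl) ⟩
        idem bottomRel                                         ∎
        where open SetoidReasoning diagramSetoid

  top-∈ : ∀ {e} (e∈S : S e) → S (idem (Factorisation.topRel (⊆U e∈S)))
  top-∈ {e} e∈S = respects to-top (relabel-∈ E.refl E.trans Perm.id π e∈S)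
    where
      open Factorisation (⊆U e∈S)
      module E = IsEquivalence d-eq
      to-top : relabel id (π ⟨$⟩ʳ_) e ≈ idem topRel
      to-top = begin
        relabel id (π ⟨$⟩ʳ_) e                                 ≈⟨ relabel-cong _ _ top-factorisation ⟩
        relabel id (π ⟨$⟩ʳ_) (relabel id (π ⟨$⟩ˡ_) (idem topRel))  ≈⟨ relabel-∘ _ _ _ _ (idem topRel) ⟩
        relabel id (λ b → π ⟨$⟩ˡ (π ⟨$⟩ʳ b)) (idem topRel)        ≈⟨ relabel-id (idem topRel) (λ _ → refl) (λ _ → inverseˡ π) ⟩
        idem topRel                                            ∎
        where open SetoidReasoning diagramSetoid

  ·-∈ : ∀ {d e} (d∈U : InU k d) (e∈U : InU k e) →
    S (idem (join (Factorisation.bottomRel d∈U) (Factorisation.topRel e∈U))) → S (d · e)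
  ·-∈ d∈U e∈U J∈S = respects (≈-sym (·-factorisation d∈U e∈U))
    (relabel-∈ J.refl (λ {x} {y} {z} → J.trans {idx x} {idx y} {idx z}) (Factorisation.π d∈U) (flip (Factorisation.π e∈U)) J∈S)
    where
      module J = IsEquivalence (join-isEquivalence _ _ (Factorisation.bottomRel-isEquivalence d∈U)
                                                       (Factorisation.topRel-isEquivalence e∈U))

  module Generation (R : FinRel k) (R-eq : IsEquivalence (Holds R)) where

    record Approximant (A : FinRel k) : Set where
      field
        idem∈S        : S (idem A)
        equivalence   : IsEquivalence (Holds A)
        ⊆R            : A ⊆ʳ R

    join-approximant : ∀ {A B} → Approximant A → Approximant B → Approximant (join A B)
    join-approximant {A} {B} α β = record
      { idem∈S        = idem-join-∈ A B A.refl B.refl (Approximant.idem∈S α) (Approximant.idem∈S β)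
      ; equivalence   = join-isEquivalence A B (Approximant.equivalence α) (Approximant.equivalence β)
      ; ⊆R            = join-least A B (Approximant.equivalence α) (Approximant.equivalence β) R-eq (Approximant.⊆R α) (Approximant.⊆R β) }
      where
        module A = IsEquivalence (Approximant.equivalence α)
        module B = IsEquivalence (Approximant.equivalence β)

    idem-generated-∈ : ∀ {A₀} → Approximant A₀ →
      (∀ a b → R a b ≡ true → ∃[ T ] Approximant T × T a b ≡ true) → S (idem R)
    idem-generated-∈ {A₀} α₀ through with cover (cartesianProduct (allFin k) (allFin k))
      where
        cover : (ps : List (Fin k × Fin k)) →
          ∃[ A ] Approximant A × (∀ {a b} → (a , b) ∈ ps → R a b ≡ true → A a b ≡ true)
        cover [] = A₀ , α₀ , λ ()
        cover ((a , b) ∷ ps) with cover ps | R a b in Rab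
        ... | A , α , covers | false = A , α , λ
          { (here refl) R′ → ⊥-elim (true≢false (trans (sym R′) Rab))
          ; (there m) R′ → covers m R′ }
        ... | A , α , covers | true with through a b Rab
        ...   | T , τ , Tab = join A T , join-approximant α τ , λ
          { (here refl) _ → ⊆-joinʳ A T (refl′ α) (refl′ τ) a b Tab
          ; (there m) R′ → ⊆-joinˡ A T (refl′ α) (refl′ τ) _ _ (covers m R′) }
          where
            refl′ : ∀ {B} → Approximant B → Reflexive (Holds B)
            refl′ β = IsEquivalence.refl (Approximant.equivalence β)
    ... | A , α , covers = respects exhausts (Approximant.idem∈S α)
      where
        exhausts : idem A ≈ idem R
        exhausts x y = ≡-from-true⇔true (Approximant.⊆R α _ _)
          (covers (∈-cartesianProduct⁺ (∈-allFin (idx x)) (∈-allFin (idx y))))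

-- Swapping two disjoint sets of equal size

module _ {k : ℕ} where

  record Swap (C D : Fin k → Bool) : Set where
    field
      ρ          : Fin k → Fin k
      C→D        : ∀ x → C x ≡ true → D (ρ x) ≡ true
      D→C        : ∀ x → D x ≡ true → C (ρ x) ≡ true
      fixes      : ∀ x → C x ≡ false → D x ≡ false → ρ x ≡ x
      involutive : ∀ x → ρ (ρ x) ≡ x

  Disjoint : (Fin k → Bool) → (Fin k → Bool) → Set
  Disjoint C D = ∀ x → C x ≡ true → D x ≡ false

  private
    remove-false : ∀ c (f : Fin k → Bool) x → f x ≡ false → remove c f x ≡ false
    remove-false c f x fx rewrite fx = refl

    remove-self : ∀ c (f : Fin k → Bool) → remove c f c ≡ false
    remove-self c f = ¬-not λ p → remove-≢ c f c p refl

  -- Extends a swap of C ∖ {c} and D ∖ {d} by the transposition of c and d.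
  module SwapStep (C D : Fin k → Bool) (disjoint : Disjoint C D)
                  (c : Fin k) (Cc : C c ≡ true) (d : Fin k) (Dd : D d ≡ true)
                  (smaller : Swap (remove c C) (remove d D)) where

    open Swap smaller renaming (ρ to ρ′; C→D to C→D′; D→C to D→C′; fixes to fixes′; involutive to involutive′)

    t : Fin k → Fin k
    t x = transpose c d ⟨$⟩ʳ x

    Dc : D c ≡ false
    Dc = disjoint c Cc

    Cd : C d ≡ false
    Cd = ¬-not λ Cd → true≢false (trans (sym Dd) (disjoint d Cd))

    d≢c : d ≢ c
    d≢c d≡c = true≢false (trans (sym Dd) (trans (cong D d≡c) Dc))

    ρ′c : ρ′ c ≡ c
    ρ′c = fixes′ c (remove-self c C) (remove-false d D c Dc)

    ρ′d : ρ′ d ≡ d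
    ρ′d = fixes′ d (remove-false c C d Cd) (remove-self d D)

    ρ′-injective : ∀ {x y} → ρ′ x ≡ ρ′ y → x ≡ y
    ρ′-injective {x} {y} eq = trans (sym (involutive′ x)) (trans (cong ρ′ eq) (involutive′ y))

    ρ′-commutes : ∀ y → ρ′ (t y) ≡ t (ρ′ y)
    ρ′-commutes y with transpose-view c d y
    ... | at-i refl rewrite ρ′c | transpose-at-i c d = ρ′d
    ... | at-j _ refl rewrite ρ′d | transpose-at-j c d d≢c = ρ′c
    ... | elsewhere y≢c y≢d = trans (cong ρ′ (transpose-elsewhere c d y y≢c y≢d))
      (sym (transpose-elsewhere c d (ρ′ y) (λ eq → y≢c (ρ′-injective (trans eq (sym ρ′c))))
                                           (λ eq → y≢d (ρ′-injective (trans eq (sym ρ′d))))))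

    ρ : Fin k → Fin k
    ρ x = t (ρ′ x)

    C→D : ∀ x → C x ≡ true → D (ρ x) ≡ true
    C→D x Cx with x ≟ c
    ... | yes refl rewrite ρ′c | transpose-at-i x d = Dd
    ... | no x≢c = subst (λ y → D y ≡ true) (sym (transpose-elsewhere c d (ρ′ x) ρ′x≢c (remove-≢ d D (ρ′ x) image))) Dρ′x
      where
        image = C→D′ x (remove-keep c C Cx x≢c)
        Dρ′x = remove-⊆ d D (ρ′ x) image
        ρ′x≢c : ρ′ x ≢ c
        ρ′x≢c eq = true≢false (trans (sym Dρ′x) (trans (cong D eq) Dc))

    D→C : ∀ x → D x ≡ true → C (ρ x) ≡ true
    D→C x Dx with x ≟ d
    ... | yes refl rewrite ρ′d | transpose-at-j c x d≢c = Cc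
    ... | no x≢d = subst (λ y → C y ≡ true) (sym (transpose-elsewhere c d (ρ′ x) (remove-≢ c C (ρ′ x) image) ρ′x≢d)) Cρ′x
      where
        image = D→C′ x (remove-keep d D Dx x≢d)
        Cρ′x = remove-⊆ c C (ρ′ x) image
        ρ′x≢d : ρ′ x ≢ d
        ρ′x≢d eq = true≢false (trans (sym Cρ′x) (trans (cong C eq) Cd))

    fixes : ∀ x → C x ≡ false → D x ≡ false → ρ x ≡ x
    fixes x Cx Dx = trans (cong t (fixes′ x (remove-false c C x Cx) (remove-false d D x Dx)))
      (transpose-elsewhere c d x (λ { refl → true≢false (trans (sym Cc) Cx) }) (λ { refl → true≢false (trans (sym Dd) Dx) }))

    involutive : ∀ x → ρ (ρ x) ≡ x
    involutive x = trans (cong t (ρ′-commutes (ρ′ x))) (trans (transpose-involutive c d (ρ′ (ρ′ x))) (involutive′ x))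

    swap : Swap C D
    swap = record { ρ = ρ ; C→D = C→D ; D→C = D→C ; fixes = fixes ; involutive = involutive }

  swap-equal-size : ∀ n (C D : Fin k → Bool) → countFin C ≡ n → countFin D ≡ n → Disjoint C D → Swap C D
  swap-equal-size zero C D |C| |D| _ = record
    { ρ = id
    ; C→D = λ x Cx → ⊥-elim (empty C |C| x Cx)
    ; D→C = λ x Dx → ⊥-elim (empty D |D| x Dx)
    ; fixes = λ _ _ _ → refl
    ; involutive = λ _ → refl }
    where
      empty : ∀ (E : Fin k → Bool) → countFin E ≡ 0 → ∀ x → E x ≢ true
      empty E |E| x Ex = 1+n≰n (subst (1 ≤_) |E| (count-≥1 E x Ex))
  swap-equal-size (suc n) C D |C| |D| disjoint =
    SwapStep.swap C D disjoint c Cc d Dd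
      (swap-equal-size n (remove c C) (remove d D)
        (suc-injective (trans (sym (count-remove C c Cc)) |C|))
        (suc-injective (trans (sym (count-remove D d Dd)) |D|))
        (λ x p → remove-false d D x (disjoint x (remove-⊆ c C x p))))
    where
      c∈C = count-≥1-elim C (subst (1 ≤_) (sym |C|) (s≤s z≤n))
      d∈D = count-≥1-elim D (subst (1 ≤_) (sym |D|) (s≤s z≤n))
      c = proj₁ c∈C
      Cc = proj₂ c∈C
      d = proj₁ d∈D
      Dd = proj₂ d∈D

-- Joining with a partition of larger blocks

module JoinWithLargerBlocks {k : ℕ} (S : Subset k) (S-sub : IsSubmonoid k S) (S-sym : ContainsSym k S)
  (X Y : FinRel k) (X-eq : IsEquivalence (Holds X)) (Y-eq : IsEquivalence (Holds Y)) (X∈S : S (idem X))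
  (smaller-block : ∀ a → 2 ≤ blockSize Y a → SmallerBlock X Y a) where

  private
    module X = IsEquivalence X-eq
    module Y = IsEquivalence Y-eq

  R : FinRel k
  R = join X Y

  R-eq : IsEquivalence (Holds R)
  R-eq = join-isEquivalence X Y X-eq Y-eq

  private module R = IsEquivalence R-eq

  X⊆R : X ⊆ʳ R
  X⊆R = ⊆-joinˡ X Y X.refl Y.refl

  open SubmonoidContainingSym S S-sub S-sym
  open Generation R R-eq

  conjugate-approximant : (π : Permutation′ k) → conjugate X (π ⟨$⟩ʳ_) ⊆ʳ R → Approximant (conjugate X (π ⟨$⟩ʳ_))
  conjugate-approximant π ⊆R = record
    { idem∈S      = idem-conjugate-∈ X-eq π X∈S
    ; equivalence = record { refl = X.refl ; sym = X.sym ; trans = X.trans }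
    ; ⊆R          = ⊆R }

  -- Two transpositions inside the R-block move the X-related pair c, c′ onto a, b.
  through-X-pair : ∀ {a b c c′} → a ≢ b → Holds R a b → Holds R a c → Holds R a c′ → c ≢ c′ → Holds X c c′ →
    ∃[ T ] Approximant T × Holds T a b
  through-X-pair {a} {b} {c} {c′} a≢b Rab Rac Rac′ c≢c′ Xcc′ =
    conjugate X (π ⟨$⟩ʳ_) , conjugate-approximant π (conjugate-⊆ R-eq X⊆R (π ⟨$⟩ʳ_) within) , moved
    where
      b₁ = transpose a c ⟨$⟩ʳ b
      π = transpose a c ∘ₚ transpose b₁ c′
      Rb₁c′ : Holds R b₁ c′
      Rb₁c′ = R.trans (R.sym (transpose-within R-eq Rac b)) (R.trans (R.sym Rab) Rac′)
      within : ∀ x → Holds R x (π ⟨$⟩ʳ x)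
      within x = R.trans (transpose-within R-eq Rac x) (transpose-within R-eq Rb₁c′ _)
      c≢b₁ : c ≢ b₁
      c≢b₁ c≡b₁ = a≢b (trans (sym (transpose-involutive a c a))
                       (trans (cong (transpose a c ⟨$⟩ʳ_) (trans (transpose-at-i a c) c≡b₁)) (transpose-involutive a c b)))
      moved : Holds X (π ⟨$⟩ʳ a) (π ⟨$⟩ʳ b)
      moved rewrite transpose-at-i a c | transpose-elsewhere b₁ c′ c c≢b₁ c≢c′ | transpose-at-i b₁ c′ = Xcc′

  -- When X is discrete on the R-block B of a, an X-block C of suitable size is swapped into B.
  module Discrete {a b} (a≢b : a ≢ b) (Rab : Holds R a b)
                  (discrete : ∀ {u v} → Holds R a u → Holds R a v → Holds X u v → u ≡ v) where

    leaves-by-Y : ∀ {b′} → Chain X Y a b′ → b′ ≡ a ⊎ ∃[ z ] Holds Y a z × z ≢ a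
    leaves-by-Y ε = inj₁ refl
    leaves-by-Y (inj₁ Xaj ◅ rest) with discrete R.refl (X⊆R _ _ Xaj) Xaj
    ... | refl = leaves-by-Y rest
    leaves-by-Y (_◅_ {j = j} (inj₂ Yaj) rest) with j ≟ a
    ... | yes refl = leaves-by-Y rest
    ... | no j≢a = inj₂ (j , Yaj , j≢a)

    Y-block-nontrivial : 2 ≤ blockSize Y a
    Y-block-nontrivial with leaves-by-Y (join⇒chain X Y X.refl Y.refl Rab)
    ... | inj₁ b≡a = ⊥-elim (a≢b (sym b≡a))
    ... | inj₂ (z , Yaz , z≢a) = count-≥2 (Y a) a z Y.refl Yaz (λ a≡z → z≢a (sym a≡z))

    c : Fin k
    c = proj₁ (smaller-block a Y-block-nontrivial)
    q : ℕ
    q = blockSize X c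
    2≤q : 2 ≤ q
    2≤q = proj₁ (proj₂ (smaller-block a Y-block-nontrivial))
    q≤Y : q ≤ blockSize Y a
    q≤Y = proj₂ (proj₂ (smaller-block a Y-block-nontrivial))

    C B : Fin k → Bool
    C = X c
    B = R a

    C-disjoint-B : Disjoint C B
    C-disjoint-B x Cx = ¬-not λ Bx →
      let w , Cw , w≢x = count-≥2-elim C 2≤q x
          Xxw = X.trans (X.sym Cx) Cw
      in w≢x (sym (discrete Bx (R.trans Bx (X⊆R _ _ Xxw)) Xxw))

    ends : Fin k → Bool
    ends x = (x == a) ∨ (x == b)

    |ends| : countFin ends ≡ 2
    |ends| = trans (count-insert (λ x → x == a) b (==-false λ b≡a → a≢b (sym b≡a)))
                   (cong suc (trans (count-insert (λ _ → false) a refl) (cong suc (count-false {k}))))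

    ends⊆B : ends ⊆ᵇ B
    ends⊆B x p with ∨-elim (x == a) p
    ... | inj₁ x=a rewrite ==-sound x=a = R.refl
    ... | inj₂ x=b rewrite ==-sound x=b = Rab

    chosen : ∃[ D ] ends ⊆ᵇ D × D ⊆ᵇ B × countFin D ≡ countFin ends + (q ∸ 2)
    chosen = choose-between (q ∸ 2) ends B ends⊆B
               (subst (_≤ countFin B) (trans (sym (m+[n∸m]≡n 2≤q)) (cong (_+ (q ∸ 2)) (sym |ends|)))
                      (≤-trans q≤Y (count-mono (⊆-joinʳ X Y X.refl Y.refl a))))

    module Swapped (D : Fin k → Bool) (ends⊆D : ends ⊆ᵇ D) (D⊆B : D ⊆ᵇ B) (swap : Swap C D) where

      open Swap swap

      ρ-injective : ∀ {x y} → ρ x ≡ ρ y → x ≡ y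
      ρ-injective {x} {y} eq = trans (sym (involutive x)) (trans (cong ρ eq) (involutive y))

      -- Either ρ u ∈ C, and then u, v ∈ D ⊆ B; or ρ u ∈ D ⊆ B, where X is discrete; or ρ fixes u and v.
      swapped-⊆R : conjugate X ρ ⊆ʳ R
      swapped-⊆R u v Xρuρv with C (ρ u) in Cρu
      ... | true = R.trans (R.sym (D⊆B u Du)) (D⊆B v Dv)
        where
          Du = subst (λ y → D y ≡ true) (involutive u) (C→D (ρ u) Cρu)
          Dv = subst (λ y → D y ≡ true) (involutive v) (C→D (ρ v) (X.trans Cρu Xρuρv))
      ... | false with D (ρ u) in Dρu
      ...   | true = subst (Holds R u) (ρ-injective (discrete Bρu Bρv Xρuρv)) R.refl
        where
          Bρu = D⊆B (ρ u) Dρu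
          Bρv = R.trans Bρu (X⊆R _ _ Xρuρv)
      ...   | false = subst₂ (Holds R) ρu≡u ρv≡v (X⊆R _ _ Xρuρv)
        where
          ρu≡u : ρ u ≡ u
          ρu≡u = trans (sym (fixes (ρ u) Cρu Dρu)) (involutive u)
          Cρv : C (ρ v) ≡ false
          Cρv = ¬-not λ Cρv → true≢false (trans (sym (X.trans Cρv (X.sym Xρuρv))) Cρu)
          Dρv : D (ρ v) ≡ false
          Dρv = ¬-not λ Dρv →
            let Bρv = D⊆B (ρ v) Dρv
            in true≢false (trans (sym Dρv) (trans (cong D (sym (discrete (R.trans Bρv (X⊆R _ _ (X.sym Xρuρv))) Bρv Xρuρv))) Dρu))
          ρv≡v : ρ v ≡ v
          ρv≡v = trans (sym (fixes (ρ v) Cρv Dρv)) (involutive v)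

      through-conjugate : ∃[ T ] Approximant T × Holds T a b
      through-conjugate =
        conjugate X ρ , conjugate-approximant (Perm.permutation ρ ρ involutive involutive) swapped-⊆R ,
        X.trans (X.sym (D→C a (ends⊆D a (∨-introˡ _ (==-refl a))))) (D→C b (ends⊆D b (∨-introʳ (b == a) (==-refl b))))

    through-swapped : ∃[ T ] Approximant T × Holds T a b
    through-swapped with chosen
    ... | D , ends⊆D , D⊆B , |D| = Swapped.through-conjugate D ends⊆D D⊆B
      (swap-equal-size q C D refl (trans |D| (trans (cong (_+ (q ∸ 2)) |ends|) (m+[n∸m]≡n 2≤q))) C-disjoint-D)
      where
        C-disjoint-D : Disjoint C D
        C-disjoint-D x Cx = ¬-not λ Dx → true≢false (trans (sym (D⊆B x Dx)) (C-disjoint-B x Cx))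

  through : ∀ a b → Holds R a b → ∃[ T ] Approximant T × Holds T a b
  through a b Rab with a ≟ b
  ... | yes refl = X , record { idem∈S = X∈S ; equivalence = X-eq ; ⊆R = X⊆R } , X.refl
  ... | no a≢b with search₂ (λ c c′ → R a c ∧ (R a c′ ∧ (not (c == c′) ∧ X c c′)))
  ...   | inj₂ (c , c′ , p) = through-X-pair a≢b Rab Rac Rac′ c≢c′ (∧-elimʳ (not (c == c′)) p″)
    where
      Rac = ∧-elimˡ (R a c) p
      p′ = ∧-elimʳ (R a c) p
      Rac′ = ∧-elimˡ (R a c′) p′
      p″ = ∧-elimʳ (R a c′) p′
      c≢c′ : c ≢ c′
      c≢c′ c≡c′ = true≢false (trans (sym (∧-elimˡ (not (c == c′)) p″)) (cong not (==-complete c≡c′)))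
  ...   | inj₁ none = Discrete.through-swapped a≢b Rab discrete
    where
      discrete : ∀ {u v} → Holds R a u → Holds R a v → Holds X u v → u ≡ v
      discrete {u} {v} Rau Rav Xuv with u ≟ v
      ... | yes u≡v = u≡v
      ... | no u≢v = ⊥-elim (true≢false (trans (sym (∧-intro Rau (∧-intro Rav (∧-intro (cong not (==-false u≢v)) Xuv))))
                                              (none u v)))

  join-∈ : S (idem R)
  join-∈ = idem-generated-∈ (record { idem∈S = X∈S ; equivalence = X-eq ; ⊆R = X⊆R }) through

-- Products of elements of different submonoids

module MixedProduct {k : ℕ} (S₁ S₂ : Subset k)
  (S₁-sub : IsSubmonoid k S₁) (S₁-sym : ContainsSym k S₁) (S₂-sub : IsSubmonoid k S₂) (S₂-sym : ContainsSym k S₂)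
  {d e : Diagram k} (d∈S₁ : S₁ d) (e∈S₂ : S₂ e) where

  private
    module Sub₁ = SubmonoidContainingSym S₁ S₁-sub S₁-sym
    module Sub₂ = SubmonoidContainingSym S₂ S₂-sub S₂-sym

    d∈U = IsSubmonoid.⊆U S₁-sub d∈S₁
    e∈U = IsSubmonoid.⊆U S₂-sub e∈S₂

    P = Factorisation.bottomRel d∈U
    Q = Factorisation.topRel e∈U
    P-eq = Factorisation.bottomRel-isEquivalence d∈U
    Q-eq = Factorisation.topRel-isEquivalence e∈U

  ∈S₁ : ∀ a → 2 ≤ blockSize P a → ¬ SmallerBlock Q P a → S₁ (d · e)
  ∈S₁ a 2≤Pa no-smaller = Sub₁.·-∈ d∈U e∈U (JoinWithLargerBlocks.join-∈ S₁ S₁-sub S₁-sym P Q P-eq Q-eq (Sub₁.bottom-∈ d∈S₁)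
    λ a′ 2≤Qa′ → a , 2≤Pa , <⇒≤ (≰⇒> λ Qa′≤Pa → no-smaller (a′ , 2≤Qa′ , Qa′≤Pa)))

  ∈S₂ : (∀ a → 2 ≤ blockSize P a → SmallerBlock Q P a) → S₂ (d · e)
  ∈S₂ smaller = Sub₂.·-∈ d∈U e∈U (IsSubmonoid.respects S₂-sub (join-comm P Q P-eq Q-eq)
    (JoinWithLargerBlocks.join-∈ S₂ S₂-sub S₂-sym Q P Q-eq P-eq (Sub₂.top-∈ e∈S₂) smaller))

  ∈S₁⊎S₂ : S₁ (d · e) ⊎ S₂ (d · e)
  ∈S₁⊎S₂ with Fin.any? (λ a → (2 ≤? blockSize P a) ×-dec ¬? (smaller-block? Q P a))
  ... | yes (a , 2≤Pa , no-smaller) = inj₁ (∈S₁ a 2≤Pa no-smaller)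
  ... | no none = inj₂ (∈S₂ smaller)
    where
      smaller : ∀ a → 2 ≤ blockSize P a → SmallerBlock Q P a
      smaller a 2≤Pa with smaller-block? Q P a
      ... | yes found  = found
      ... | no missing = ⊥-elim (none (a , 2≤Pa , missing))

theorem5p3 : (k : ℕ) → k ≥ 1 → (S₁ S₂ : Subset k) →
    IsSubmonoid k S₁ → ContainsSym k S₁ →
    IsSubmonoid k S₂ → ContainsSym k S₂ →
    IsSubmonoid k (S₁ ∪ S₂)
theorem5p3 k _ S₁ S₂ S₁-sub S₁-sym S₂-sub S₂-sym = record
  { respects = λ d≈e → Sum.map (S₁.respects d≈e) (S₂.respects d≈e)
  ; ⊆U       = [ S₁.⊆U , S₂.⊆U ]′
  ; has-one  = inj₁ S₁.has-one
  ; closed   = closed }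
  where
    module S₁ = IsSubmonoid S₁-sub
    module S₂ = IsSubmonoid S₂-sub
    closed : ∀ {d e} → (S₁ ∪ S₂) d → (S₁ ∪ S₂) e → (S₁ ∪ S₂) (d · e)
    closed (inj₁ d∈S₁) (inj₁ e∈S₁) = inj₁ (S₁.closed d∈S₁ e∈S₁)
    closed (inj₂ d∈S₂) (inj₂ e∈S₂) = inj₂ (S₂.closed d∈S₂ e∈S₂)
    closed (inj₁ d∈S₁) (inj₂ e∈S₂) = MixedProduct.∈S₁⊎S₂ S₁ S₂ S₁-sub S₁-sym S₂-sub S₂-sym d∈S₁ e∈S₂
    closed (inj₂ d∈S₂) (inj₁ e∈S₁) = Sum.swap (MixedProduct.∈S₁⊎S₂ S₂ S₁ S₂-sub S₂-sym S₁-sub S₁-sym d∈S₂ e∈S₁)
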